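{- Let $s\ge 3$ and let $(G,W,k)$ be an instance of Seeded $s$-Club in which $W$ is a clique in $G$. If there is a vertex $v\in N_{\lfloor (s+1)/2\rfloor-1}(W)$ with $|N_{\lfloor s/2\rfloor}(v)|\ge k$, then $(G,W,k)$ is a yes-instance.
   Context: Seeded $s$-Club: given an undirected graph $G=(V,E)$, a set $W\subseteq V$ and an integer $k\ge 1$, decide whether $G$ contains a vertex set $S$ with $W\subseteq S$, $|S|\ge k$, and $G[S]$ of diameter at most $s$. For $W\subseteq V$ and $i\ge0$, $N_i(W)$ denotes the set of vertices $u$ with $\min_{w\in W}\mathrm{dist}_G(u,w)=i$; for a vertex $v$, $N_i(v)=N_i(\{v\})$. -}

module Defs where

open import Data.Nat using (ℕ; zero; suc; _≤_; _≥_; _∸_; ⌊_/2⌋)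
open import Data.Fin using (Fin)
open import Data.Fin.Subset using (Subset; _∈_; _⊆_; ∣_∣)
open import Data.Product using (Σ; ∃; ∃-syntax; _×_; _,_)
open import Data.Unit using (⊤)
open import Relation.Nullary using (¬_)
open import Relation.Binary.PropositionalEquality using (_≡_)

record Graph : Set₁ where
  field
    n       : ℕ
    _~_     : Fin n → Fin n → Set
    ~-sym   : ∀ {u v} → u ~ v → v ~ u
    ~-irrefl : ∀ {u} → ¬ (u ~ u)

open Graph public

module _ (G : Graph) where

  data WalkIn (P : Fin (n G) → Set) : Fin (n G) → Fin (n G) → ℕ → Set where
    here : ∀ {u} → P u → WalkIn P u u zero
    step : ∀ {u w v ℓ} → P u → _~_ G u w → WalkIn P w v ℓ → WalkIn P u v (suc ℓ)

  DistLeIn : (Fin (n G) → Set) → Fin (n G) → Fin (n G) → ℕ → Set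
  DistLeIn P u v d = ∃[ ℓ ] (ℓ ≤ d × WalkIn P u v ℓ)

  DistLe : Fin (n G) → Fin (n G) → ℕ → Set
  DistLe = DistLeIn (λ _ → ⊤)

  -- u ∈ N_i(W), i.e. min_{w ∈ W} dist_G(u,w) = i
  -- (some w ∈ W at distance ≤ i, and no w ∈ W at distance < i).
  InNbrSet : Subset (n G) → ℕ → Fin (n G) → Set
  InNbrSet W i u =
    (∃[ w ] (w ∈ W × DistLe u w i)) ×
    (∀ w → w ∈ W → ∀ j → suc j ≤ i → ¬ DistLe u w j)

  -- u ∈ N_i(v) = N_i({v}), i.e. dist_G(u,v) = i
  InNbrV : Fin (n G) → ℕ → Fin (n G) → Set
  InNbrV v i u = DistLe u v i × (∀ j → suc j ≤ i → ¬ DistLe u v j)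

  IsClique : Subset (n G) → Set
  IsClique W = ∀ u v → u ∈ W → v ∈ W → ¬ (u ≡ v) → _~_ G u v

  DiamAtMost : Subset (n G) → ℕ → Set
  DiamAtMost S s = ∀ u v → u ∈ S → v ∈ S → DistLeIn (_∈ S) u v s

  SeededClubYes : ℕ → Subset (n G) → ℕ → Set
  SeededClubYes s W k = ∃[ S ] (W ⊆ S × k ≤ ∣ S ∣ × DiamAtMost S s)

  CardAtLeast : (Fin (n G) → Set) → ℕ → Set
  CardAtLeast Q k = ∃[ T ] (k ≤ ∣ T ∣ × (∀ u → u ∈ T → Q u))

-- Let w ∈ W realise dist(v, W) = ⌊(s+1)/2⌋ − 1, and let S consist of W, the vertices of a
-- shortest walk from w to v, and those of a shortest walk to v from each of the k vertices at
-- distance ⌊s/2⌋ from v. Every added vertex lies within ⌊s/2⌋ of v inside S, and every vertex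
-- of W within ⌊(s+1)/2⌋ of v (through w, as W is a clique), so routing through v gives
-- diameter at most max(2⌊s/2⌋, ⌊(s+1)/2⌋ + ⌊s/2⌋, 1) = s.
module Submission where

open import Defs
open import Data.Nat using (ℕ; zero; suc; _+_; _≤_; _∸_; ⌊_/2⌋; z≤n; s≤s)
open import Data.Nat.Properties
  using (≤-refl; ≤-trans; ≤-reflexive; n≤1+n; +-mono-≤; +-monoʳ-≤; +-comm;
         ⌊n/2⌋+⌈n/2⌉≡n; ⌊n/2⌋≤⌈n/2⌉)
open import Data.Fin using (Fin; zero; suc)
open import Data.Fin.Properties using (any?; _≟_)
open import Data.Fin.Subset using (Subset; _∈_; _⊆_; _∪_)
open import Data.Fin.Subset.Properties using (_∈?_; p⊆q⇒∣p∣≤∣q∣; p⊆p∪q; q⊆p∪q; x∈p∪q⁻)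
open import Data.Vec using (tabulate)
open import Data.Vec.Properties using (lookup∘tabulate; []=⇒lookup; lookup⇒[]=)
open import Data.List using (List; []; _∷_)
open import Data.List.Relation.Unary.Any using (here; there)
import Data.List.Membership.Propositional as ListMembership
import Data.List.Membership.DecPropositional as ListDecMembership
open import Data.Product using (∃-syntax; _,_; proj₁)
open import Data.Sum using (inj₁; inj₂)
open import Data.Unit using (⊤; tt)
open import Function using (_∘_)
open import Relation.Nullary using (does; yes; no; contradiction)
open import Relation.Nullary.Decidable using (dec-true)
open import Relation.Unary using (Decidable)
open import Relation.Binary.PropositionalEquality using (refl; sym; trans; subst)

module _ {m : ℕ} {P : Fin m → Set} (P? : Decidable P) where

  subsetOf : Subset m
  subsetOf = tabulate (does ∘ P?)

  ∈-subsetOf⁺ : ∀ {x} → P x → x ∈ subsetOf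
  ∈-subsetOf⁺ {x} px = lookup⇒[]= x _ (trans (lookup∘tabulate _ x) (dec-true (P? x) px))

  ∈-subsetOf⁻ : ∀ {x} → x ∈ subsetOf → P x
  ∈-subsetOf⁻ {x} x∈ with P? x | trans (sym (lookup∘tabulate (does ∘ P?) x)) ([]=⇒lookup x∈)
  ... | yes px | _ = px
  ... | no _   | ()

⌊n/2⌋+⌊n/2⌋≤n : ∀ m → ⌊ m /2⌋ + ⌊ m /2⌋ ≤ m
⌊n/2⌋+⌊n/2⌋≤n m = ≤-trans (+-monoʳ-≤ ⌊ m /2⌋ (⌊n/2⌋≤⌈n/2⌉ m)) (≤-reflexive (⌊n/2⌋+⌈n/2⌉≡n m))

module Walks (G : Graph) where

  open ListMembership using () renaming (_∈_ to _∈ₗ_)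

  private
    V = Fin (n G)

  Walk : V → V → ℕ → Set
  Walk = WalkIn G (λ _ → ⊤)

  module _ {P Q : V → Set} where

    WalkIn-map : (∀ {x} → P x → Q x) → ∀ {a b l} → WalkIn G P a b l → WalkIn G Q a b l
    WalkIn-map f (here p)     = here (f p)
    WalkIn-map f (step p e w) = step (f p) e (WalkIn-map f w)

    DistLeIn-mono : (∀ {x} → P x → Q x) → ∀ {a b d} → DistLeIn G P a b d → DistLeIn G Q a b d
    DistLeIn-mono f (l , l≤d , w) = l , l≤d , WalkIn-map f w

  module _ {P : V → Set} where

    source-holds : ∀ {a b l} → WalkIn G P a b l → P a
    source-holds (here p)     = p
    source-holds (step p _ _) = p

    _++ʷ_ : ∀ {a b c l l′} → WalkIn G P a b l → WalkIn G P b c l′ → WalkIn G P a c (l + l′)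
    here _     ++ʷ w′ = w′
    step p e w ++ʷ w′ = step p e (w ++ʷ w′)

    reverseʷ : ∀ {a b l} → WalkIn G P a b l → WalkIn G P b a l
    reverseʷ (here p) = here p
    reverseʷ {a} {b} {suc l} (step p e w) =
      subst (WalkIn G P b a) (+-comm l 1)
            (reverseʷ w ++ʷ step (source-holds w) (~-sym G e) (here p))

    vertices : ∀ {a b l} → WalkIn G P a b l → List V
    vertices (here {u} _)     = u ∷ []
    vertices (step {u} _ _ w) = u ∷ vertices w

    source∈vertices : ∀ {a b l} (w : WalkIn G P a b l) → a ∈ₗ vertices w
    source∈vertices (here _)     = here refl
    source∈vertices (step _ _ _) = here refl

    restrict : ∀ {Q : V → Set} {a b l} (w : WalkIn G P a b l) →
               (∀ {y} → y ∈ₗ vertices w → Q y) → WalkIn G Q a b l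
    restrict (here _)     Q-on = here (Q-on (here refl))
    restrict (step _ e w) Q-on = step (Q-on (here refl)) e (restrict w (Q-on ∘ there))

    DistLeIn-weaken : ∀ {a b d d′} → d ≤ d′ → DistLeIn G P a b d → DistLeIn G P a b d′
    DistLeIn-weaken d≤d′ (l , l≤d , w) = l , ≤-trans l≤d d≤d′ , w

    DistLeIn-step : ∀ {a b c d} → P a → _~_ G a b → DistLeIn G P b c d → DistLeIn G P a c (suc d)
    DistLeIn-step p e (l , l≤d , w) = suc l , s≤s l≤d , step p e w

    DistLeIn-via : ∀ {a b c d d′ e} → DistLeIn G P a c d → DistLeIn G P b c d′ → d + d′ ≤ e →
                   DistLeIn G P a b e
    DistLeIn-via (l , l≤d , w) (l′ , l′≤d′ , w′) d+d′≤e =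
      l + l′ , ≤-trans (+-mono-≤ l≤d l′≤d′) d+d′≤e , w ++ʷ reverseʷ w′

  suffix : ∀ {P Q : V → Set} {a b l} (w : WalkIn G P a b l) →
           (∀ {y} → y ∈ₗ vertices w → Q y) → ∀ {x} → x ∈ₗ vertices w → DistLeIn G Q x b l
  suffix w@(here _)     Q-on (here refl) = _ , ≤-refl , restrict w Q-on
  suffix w@(step _ _ _) Q-on (here refl) = _ , ≤-refl , restrict w Q-on
  suffix (step _ _ w)   Q-on (there x∈)  = DistLeIn-weaken (n≤1+n _) (suffix w (Q-on ∘ there) x∈)

module Hubs (G : Graph) where

  open Walks G
  open ListMembership using () renaming (_∈_ to _∈ₗ_)
  open ListDecMembership (_≟_ {n G}) using () renaming (_∈?_ to _∈ₗ?_)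

  private
    V = Fin (n G)

  record Spoke (c : V) : Set where
    constructor spoke
    field
      {source} : V
      length   : ℕ
      walk     : Walk source c length

  open Spoke public

  WithinRadius : Subset (n G) → V → ℕ → Set
  WithinRadius B c r = ∀ {x} → x ∈ B → DistLeIn G (_∈ B) x c r

  module _ {m : ℕ} {c : V} (σ : Fin m → Spoke c) where

    OnSpoke : V → Set
    OnSpoke x = ∃[ i ] x ∈ₗ vertices (walk (σ i))

    onSpoke? : Decidable OnSpoke
    onSpoke? x = any? (λ i → x ∈ₗ? vertices (walk (σ i)))

    hub : Subset (n G)
    hub = subsetOf onSpoke?

    onSpoke⇒∈hub : ∀ {i x} → x ∈ₗ vertices (walk (σ i)) → x ∈ hub
    onSpoke⇒∈hub {i} x∈ = ∈-subsetOf⁺ onSpoke? (i , x∈)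

    spoke-within-hub : ∀ i → WalkIn G (_∈ hub) (source (σ i)) c (length (σ i))
    spoke-within-hub i = restrict (walk (σ i)) onSpoke⇒∈hub

    source∈hub : ∀ i → source (σ i) ∈ hub
    source∈hub i = onSpoke⇒∈hub (source∈vertices (walk (σ i)))

    hub-withinRadius : ∀ {r} → (∀ i → length (σ i) ≤ r) → WithinRadius hub c r
    hub-withinRadius short x∈hub with ∈-subsetOf⁻ onSpoke? x∈hub
    ... | i , x∈ = DistLeIn-weaken (short i) (suffix (walk (σ i)) onSpoke⇒∈hub x∈)

  -- Every vertex of W reaches c through w, within q + 1.
  clique∪ball-diameter :
    ∀ {W B c r q s w} → IsClique G W → WithinRadius B c r →
    w ∈ W → DistLeIn G (_∈ B) w c q →
    1 ≤ s → r + r ≤ s → suc q + r ≤ s → DiamAtMost G (W ∪ B) s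
  clique∪ball-diameter {W} {B} {c} {r} {q} {s} {w} clique ball w∈W w-near 1≤s 2r≤s q+1+r≤s =
    diameter
    where
    S = W ∪ B

    inS : ∀ {x d} → DistLeIn G (_∈ B) x c d → DistLeIn G (_∈ S) x c d
    inS = DistLeIn-mono (q⊆p∪q W B)

    seed-near : ∀ {x} → x ∈ W → DistLeIn G (_∈ S) x c (suc q)
    seed-near {x} x∈W with x ≟ w
    ... | yes refl = DistLeIn-weaken (n≤1+n q) (inS w-near)
    ... | no x≢w   = DistLeIn-step (p⊆p∪q B x∈W) (clique x w x∈W w∈W x≢w) (inS w-near)

    diameter : DiamAtMost G S s
    diameter x y x∈S y∈S with x∈p∪q⁻ W B x∈S | x∈p∪q⁻ W B y∈S
    ... | inj₂ x∈B | inj₂ y∈B = DistLeIn-via (inS (ball x∈B)) (inS (ball y∈B)) 2r≤s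
    ... | inj₁ x∈W | inj₂ y∈B = DistLeIn-via (seed-near x∈W) (inS (ball y∈B)) q+1+r≤s
    ... | inj₂ x∈B | inj₁ y∈W =
      DistLeIn-via (inS (ball x∈B)) (seed-near y∈W) (subst (_≤ s) (+-comm (suc q) r) q+1+r≤s)
    ... | inj₁ x∈W | inj₁ y∈W with x ≟ y
    ...   | yes refl = 0 , z≤n , here x∈S
    ...   | no x≢y   = 1 , 1≤s , step x∈S (clique x y x∈W y∈W x≢y) (here y∈S)

lemma11 : (G : Graph) (W : Subset (n G)) (k s : ℕ) → 1 ≤ k → 3 ≤ s →
          IsClique G W →
          (v : Fin (n G)) → InNbrSet G W (⌊ suc s /2⌋ ∸ 1) v →
          CardAtLeast G (InNbrV G v ⌊ s /2⌋) k →
          SeededClubYes G s W k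
lemma11 G W k (suc t) _ _ clique v ((w , w∈W , l₀ , l₀≤d , v⇝w) , _) (T , k≤∣T∣ , T-far) =
  W ∪ hub σ , p⊆p∪q (hub σ) , ≤-trans k≤∣T∣ (p⊆q⇒∣p∣≤∣q∣ (q⊆p∪q W (hub σ) ∘ T⊆hub)) ,
  clique∪ball-diameter clique (hub-withinRadius σ short) w∈W
    (l₀ , l₀≤d , spoke-within-hub σ zero)
    (s≤s z≤n) (⌊n/2⌋+⌊n/2⌋≤n (suc t)) (s≤s (≤-reflexive (⌊n/2⌋+⌈n/2⌉≡n t)))
  -- With s = t + 1, the radius ⌊(s+1)/2⌋ ∸ 1 of w reduces to ⌊t/2⌋ and ⌊s/2⌋ is ⌈t/2⌉.
  where
  open Walks G
  open Hubs G

  -- Index zero is the walk from w; index suc u is a walk from u if u ∈ T and the empty walk at v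
  -- otherwise.
  σ : Fin (suc (n G)) → Spoke v
  σ zero = spoke l₀ (reverseʷ v⇝w)
  σ (suc u) with u ∈? T
  ... | yes u∈T = let (_ , _ , u⇝v) = proj₁ (T-far u u∈T) in spoke _ u⇝v
  ... | no _    = spoke 0 (here tt)

  short : ∀ i → length (σ i) ≤ ⌊ suc t /2⌋
  short zero = ≤-trans l₀≤d (⌊n/2⌋≤⌈n/2⌉ t)
  short (suc u) with u ∈? T
  ... | yes u∈T = let (_ , l≤h , _) = proj₁ (T-far u u∈T) in l≤h
  ... | no _    = z≤n

  T⊆hub : T ⊆ hub σ
  T⊆hub {u} u∈T with u ∈? T | source∈hub σ (suc u)
  ... | yes _  | u∈hub = u∈hub
  ... | no u∉T | _     = contradiction u∈T u∉T
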